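{- Let $m$ be a refinement mapping from a high-level BAT $\mathcal{D}^h$ to a low-level BAT $\mathcal{D}^l$. Suppose $\mathcal{D}^h_{S_0}$ is a complete theory (i.e., for any high-level situation-suppressed formula $\phi$, either $\mathcal{D}^h_{S_0}\models\phi[S_0]$ or $\mathcal{D}^h_{S_0}\models\neg\phi[S_0]$) and $\mathcal{D}^l$ is satisfiable. If $\mathcal{D}^h$ is a sound abstraction of $\mathcal{D}^l$ relative to $m$, then $\mathcal{D}^h$ is also a complete abstraction of $\mathcal{D}^l$ relative to $m$.
   Context: Situation calculus setting. Objects are a countably infinite set $\mathcal{N}$ of standard names (unique names and domain closure); no function symbols other than constants; no non-fluent predicates. Situations: $S_0$ and $do(a,s)$. $Poss(a,s)$ means $a$ is executable in $s$. A basic action theory (BAT) over finitely many action types $\mathcal{A}$ and fluents $\mathcal{F}$ is the union of: initial-state axioms $\mathcal{D}_{S_0}$; precondition axioms $Poss(A(\vec x),s)\equiv\phi^{Poss}_A(\vec x,s)$; successor state axioms $F(\vec x,do(a,s))\equiv\phi^{ssa}_F(\vec x,a,s)$ (right-hand sides uniform in $s$); $\mathcal{D}_{ca}$, unique names and domain closure for actions; $\mathcal{D}_{coa}$, unique names and domain closure for objects; and the foundational axioms $\Sigma$. A situation-suppressed formula omits situation arguments of fluents; $\phi[s]$ restores $s$. ConGolog programs $\delta::=\alpha\mid\varphi?\mid\delta_1;\delta_2\mid\delta_1|\delta_2\mid\pi x.\delta\mid\delta^*\mid\delta_1\|\delta_2$, $nil=True?$; $\mathcal{C}$ are the axioms: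 $Trans(\alpha,s,\delta',s')\equiv s'=do(\alpha,s)\land Poss(\alpha,s)\land\delta'=True?$; $Trans(\varphi?,s,\delta',s')\equiv False$; $Trans(\delta_1;\delta_2,s,\delta',s')\equiv\exists\delta_1'(Trans(\delta_1,s,\delta_1',s')\land\delta'=\delta_1';\delta_2)\lor(Final(\delta_1,s)\land Trans(\delta_2,s,\delta',s'))$; $Trans(\delta_1|\delta_2,\cdot)\equiv Trans(\delta_1,\cdot)\lor Trans(\delta_2,\cdot)$; $Trans(\pi x.\delta,s,\delta',s')\equiv\exists x.Trans(\delta,s,\delta',s')$; $Trans(\delta^*,s,\delta',s')\equiv\exists\delta''(Trans(\delta,s,\delta'',s')\land\delta'=\delta'';\delta^*)$; $Trans(\delta_1\|\delta_2,s,\delta',s')\equiv\exists\delta_1'(Trans(\delta_1,s,\delta_1',s')\land\delta'=\delta_1'\|\delta_2)\lor\exists\delta_2'(Trans(\delta_2,s,\delta_2',s')\land\delta'=\delta_1\|\delta_2')$; $Final(\alpha,s)\equiv False$; $Final(\varphi?,s)\equiv\varphi[s]$; $Final(\delta_1;\delta_2,s)\equiv Final(\delta_1,s)\land Final(\delta_2,s)$; $Final(\delta_1|\delta_2,s)\equiv Final(\delta_1,s)\lor Final(\delta_2,s)$; $Final(\pi x.\delta,s)\equiv\exists x.Final(\delta,s)$; $Final(\delta^*,s)\equiv True$; $Final(\delta_1\|\delta_2,s)\equiv Final(\delta_1,s)\land Final(\delta_2,s)$. $Do(\delta,s,s')\doteq\exists\delta'.Trans^*(\delta,s,\delta',s')\land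 Final(\delta',s')$, $Trans^*$ the reflexive transitive closure. $\mathcal{D}^h$ and $\mathcal{D}^l$ have action types $\mathcal{A}^h,\mathcal{A}^l$ and fluents $\mathcal{F}^h,\mathcal{F}^l$, sharing only $\mathcal{N}$. A refinement mapping $m$ maps each $A\in\mathcal{A}^h$ to a situation-determined ConGolog program $m(A(\vec x))$ over $\mathcal{D}^l$ with free variables $\vec x$, and each $F\in\mathcal{F}^h$ to a situation-suppressed low-level formula $m(F(\vec x))$. For a model $M_h$ of $\mathcal{D}^h$ and a model $M_l$ of $\mathcal{D}^l\cup\mathcal{C}$: $s_h\simeq_m^{M_h,M_l}s_l$ iff for all $F\in\mathcal{F}^h$ and assignments $v$, $M_h,v[s/s_h]\models F(\vec x,s)$ iff $M_l,v[s/s_l]\models m(F(\vec x))[s]$. A relation $B$ between situation domains is an $m$-bisimulation if each $\langle s_h,s_l\rangle\in B$ satisfies: (1) $s_h\simeq_m^{M_h,M_l}s_l$; (2) for each $A\in\mathcal{A}^h$ and $v$, if some $s_h'$ has $M_h,v[s/s_h,s'/s_h']\models Poss(A(\vec x),s)\land s'=do(A(\vec x),s)$ then some $s_l'$ has $M_l,v[s/s_l,s'/s_l']\models Do(m(A(\vec x)),s,s')$ and $\langle s_h',s_l'\rangle\in B$; (3) conversely, if some $s_l'$ has $M_l,v[s/s_l,s'/s_l']\models Do(m(A(\vec x)),s,s')$ then some $s_h'$ has $M_h,v[s/s_h,s'/s_h']\models Poss(A(\vec x),s)\land s'=do(A(\vec x),s)$ and $\langle s_h',s_l'\rangle\in B$.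 $M_h\sim_m M_l$ iff some $m$-bisimulation contains $\langle S_0^{M_h},S_0^{M_l}\rangle$. $\mathcal{D}^h$ is a sound abstraction of $\mathcal{D}^l$ relative to $m$ iff for every model $M_l$ of $\mathcal{D}^l\cup\mathcal{C}$ there is a model $M_h$ of $\mathcal{D}^h$ with $M_h\sim_m M_l$; it is a complete abstraction iff for every model $M_h$ of $\mathcal{D}^h$ there is a model $M_l$ of $\mathcal{D}^l\cup\mathcal{C}$ with $M_h\sim_m M_l$. -}

module Defs where

open import Data.Nat using (ℕ; suc; zero)
open import Data.Fin using (Fin; zero; suc)
open import Data.Vec using (Vec; []; _∷_; lookup; map)
open import Data.Maybe using (Maybe; just; nothing)
open import Data.Product using (Σ; Σ-syntax; _×_; _,_; proj₁; proj₂)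
open import Data.Sum using (_⊎_)
open import Data.Empty using (⊥)
open import Data.Unit using (⊤)
open import Relation.Nullary using (¬_)
open import Relation.Binary.PropositionalEquality using (_≡_)
open import Relation.Binary.Construct.Closure.ReflexiveTransitive using (Star)

_⟺_ : Set → Set → Set
A ⟺ B = (A → B) × (B → A)

-- Objects are the standard names ℕ
-- (unique names + domain closure for objects, D_coa); there are no
-- function symbols and no non-fluent predicates.

record Sig : Set where
  field
    nA  : ℕ
    arA : Fin nA → ℕ
    nF  : ℕ
    arF : Fin nF → ℕ

thick : ∀ {n} → Fin (suc n) → Fin (suc n) → Maybe (Fin n)
thick zero zero = nothing
thick zero (suc j) = just j
thick {suc n} (suc i) zero = just zero
thick {suc n} (suc i) (suc j) with thick i j
... | nothing = nothing
... | just j' = just (suc j')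

module Lang (S : Sig) where
  open Sig S

  -- Ground actions A(n⃗): unique names + domain closure for actions (D_ca)
  Act : Set
  Act = Σ (Fin nA) (λ A → Vec ℕ (arA A))

  data OTerm (n : ℕ) : Set where
    ovar : Fin n → OTerm n
    name : ℕ → OTerm n

  data ATerm (n k : ℕ) : Set where
    avar  : Fin k → ATerm n k
    aterm : (A : Fin nA) → Vec (OTerm n) (arA A) → ATerm n k

  data Fml (n k : ℕ) : Set where
    trueF falseF : Fml n k
    flu  : (F : Fin nF) → Vec (OTerm n) (arF F) → Fml n k
    eqO  : OTerm n → OTerm n → Fml n k
    eqA  : ATerm n k → ATerm n k → Fml n k
    notF : Fml n k → Fml n k
    andF orF impF : Fml n k → Fml n k → Fml n k
    allO exO : Fml (suc n) k → Fml n k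
    allA exA : Fml n (suc k) → Fml n k

  data Prog (n k : ℕ) : Set where
    prim : ATerm n k → Prog n k
    test : Fml n k → Prog n k
    seq  : Prog n k → Prog n k → Prog n k
    ndet : Prog n k → Prog n k → Prog n k
    piO  : Prog (suc n) k → Prog n k
    piA  : Prog n (suc k) → Prog n k
    star : Prog n k → Prog n k
    par  : Prog n k → Prog n k → Prog n k

  nil : ∀ {n k} → Prog n k
  nil = test trueF

  substOT : ∀ {n} → Fin (suc n) → ℕ → OTerm (suc n) → OTerm n
  substOT i v (ovar j) with thick i j
  ... | nothing = name v
  ... | just j' = ovar j'
  substOT i v (name c) = name c

  substATO : ∀ {n k} → Fin (suc n) → ℕ → ATerm (suc n) k → ATerm n k
  substATO i v (avar j) = avar j
  substATO i v (aterm A ts) = aterm A (map (substOT i v) ts)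

  substATA : ∀ {n k} → Fin (suc k) → Act → ATerm n (suc k) → ATerm n k
  substATA i g (avar j) with thick i j
  ... | nothing = aterm (proj₁ g) (map name (proj₂ g))
  ... | just j' = avar j'
  substATA i g (aterm A ts) = aterm A ts

  substFO : ∀ {n k} → Fin (suc n) → ℕ → Fml (suc n) k → Fml n k
  substFO i v trueF = trueF
  substFO i v falseF = falseF
  substFO i v (flu F ts) = flu F (map (substOT i v) ts)
  substFO i v (eqO t u) = eqO (substOT i v t) (substOT i v u)
  substFO i v (eqA t u) = eqA (substATO i v t) (substATO i v u)
  substFO i v (notF φ) = notF (substFO i v φ)
  substFO i v (andF φ ψ) = andF (substFO i v φ) (substFO i v ψ)
  substFO i v (orF φ ψ) = orF (substFO i v φ) (substFO i v ψ)
  substFO i v (impF φ ψ) = impF (substFO i v φ) (substFO i v ψ)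
  substFO i v (allO φ) = allO (substFO (suc i) v φ)
  substFO i v (exO φ) = exO (substFO (suc i) v φ)
  substFO i v (allA φ) = allA (substFO i v φ)
  substFO i v (exA φ) = exA (substFO i v φ)

  substFA : ∀ {n k} → Fin (suc k) → Act → Fml n (suc k) → Fml n k
  substFA i g trueF = trueF
  substFA i g falseF = falseF
  substFA i g (flu F ts) = flu F ts
  substFA i g (eqO t u) = eqO t u
  substFA i g (eqA t u) = eqA (substATA i g t) (substATA i g u)
  substFA i g (notF φ) = notF (substFA i g φ)
  substFA i g (andF φ ψ) = andF (substFA i g φ) (substFA i g ψ)
  substFA i g (orF φ ψ) = orF (substFA i g φ) (substFA i g ψ)
  substFA i g (impF φ ψ) = impF (substFA i g φ) (substFA i g ψ)
  substFA i g (allO φ) = allO (substFA i g φ)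
  substFA i g (exO φ) = exO (substFA i g φ)
  substFA i g (allA φ) = allA (substFA (suc i) g φ)
  substFA i g (exA φ) = exA (substFA (suc i) g φ)

  substPO : ∀ {n k} → Fin (suc n) → ℕ → Prog (suc n) k → Prog n k
  substPO i v (prim t) = prim (substATO i v t)
  substPO i v (test φ) = test (substFO i v φ)
  substPO i v (seq p q) = seq (substPO i v p) (substPO i v q)
  substPO i v (ndet p q) = ndet (substPO i v p) (substPO i v q)
  substPO i v (piO p) = piO (substPO (suc i) v p)
  substPO i v (piA p) = piA (substPO i v p)
  substPO i v (star p) = star (substPO i v p)
  substPO i v (par p q) = par (substPO i v p) (substPO i v q)

  substPA : ∀ {n k} → Fin (suc k) → Act → Prog n (suc k) → Prog n k
  substPA i g (prim t) = prim (substATA i g t)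
  substPA i g (test φ) = test (substFA i g φ)
  substPA i g (seq p q) = seq (substPA i g p) (substPA i g q)
  substPA i g (ndet p q) = ndet (substPA i g p) (substPA i g q)
  substPA i g (piO p) = piO (substPA i g p)
  substPA i g (piA p) = piA (substPA (suc i) g p)
  substPA i g (star p) = star (substPA i g p)
  substPA i g (par p q) = par (substPA i g p) (substPA i g q)

  -- instantiate the free object variables x⃗ (variable i ↦ lookup xs i)
  instP : ∀ {n} → Vec ℕ n → Prog n 0 → Prog 0 0
  instP [] p = p
  instP (v ∷ vs) p = instP vs (substPO zero v p)

  record Structure : Set₁ where
    field
      Sit   : Set
      S0    : Sit
      doS   : Act → Sit → Sit
      Poss  : Act → Sit → Set
      Holds : (F : Fin nF) → Vec ℕ (arF F) → Sit → Set
      _⊏_   : Sit → Sit → Set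

  evalO : ∀ {n} → Vec ℕ n → OTerm n → ℕ
  evalO ρ (ovar i) = lookup ρ i
  evalO ρ (name c) = c

  evalA : ∀ {n k} → Vec ℕ n → Vec Act k → ATerm n k → Act
  evalA ρ σ (avar i) = lookup σ i
  evalA ρ σ (aterm A ts) = A , map (evalO ρ) ts

  sat : (M : Structure) → ∀ {n k} → Fml n k → Vec ℕ n → Vec Act k → Structure.Sit M → Set
  sat M trueF ρ σ s = ⊤
  sat M falseF ρ σ s = ⊥
  sat M (flu F ts) ρ σ s = Structure.Holds M F (map (evalO ρ) ts) s
  sat M (eqO t u) ρ σ s = evalO ρ t ≡ evalO ρ u
  sat M (eqA t u) ρ σ s = evalA ρ σ t ≡ evalA ρ σ u
  sat M (notF φ) ρ σ s = ¬ sat M φ ρ σ s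
  sat M (andF φ ψ) ρ σ s = sat M φ ρ σ s × sat M ψ ρ σ s
  sat M (orF φ ψ) ρ σ s = sat M φ ρ σ s ⊎ sat M ψ ρ σ s
  sat M (impF φ ψ) ρ σ s = sat M φ ρ σ s → sat M ψ ρ σ s
  sat M (allO φ) ρ σ s = ∀ (x : ℕ) → sat M φ (x ∷ ρ) σ s
  sat M (exO φ) ρ σ s = Σ[ x ∈ ℕ ] sat M φ (x ∷ ρ) σ s
  sat M (allA φ) ρ σ s = ∀ (a : Act) → sat M φ ρ (a ∷ σ) s
  sat M (exA φ) ρ σ s = Σ[ a ∈ Act ] sat M φ ρ (a ∷ σ) s

  module Golog (M : Structure) where
    open Structure M

    data Final : Prog 0 0 → Sit → Set where
      f-test : ∀ {φ s} → sat M φ [] [] s → Final (test φ) s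
      f-seq  : ∀ {p q s} → Final p s → Final q s → Final (seq p q) s
      f-ndl  : ∀ {p q s} → Final p s → Final (ndet p q) s
      f-ndr  : ∀ {p q s} → Final q s → Final (ndet p q) s
      f-piO  : ∀ {p s} (v : ℕ) → Final (substPO zero v p) s → Final (piO p) s
      f-piA  : ∀ {p s} (g : Act) → Final (substPA zero g p) s → Final (piA p) s
      f-star : ∀ {p s} → Final (star p) s
      f-par  : ∀ {p q s} → Final p s → Final q s → Final (par p q) s

    data Trans : Prog 0 0 → Sit → Prog 0 0 → Sit → Set where
      t-prim : ∀ {t s} → Poss (evalA [] [] t) s →
               Trans (prim t) s nil (doS (evalA [] [] t) s)
      t-seq1 : ∀ {p p' q s s'} → Trans p s p' s' → Trans (seq p q) s (seq p' q) s'
      t-seq2 : ∀ {p q q' s s'} → Final p s → Trans q s q' s' → Trans (seq p q) s q' s'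
      t-ndl  : ∀ {p q d s s'} → Trans p s d s' → Trans (ndet p q) s d s'
      t-ndr  : ∀ {p q d s s'} → Trans q s d s' → Trans (ndet p q) s d s'
      t-piO  : ∀ {p d s s'} (v : ℕ) → Trans (substPO zero v p) s d s' → Trans (piO p) s d s'
      t-piA  : ∀ {p d s s'} (g : Act) → Trans (substPA zero g p) s d s' → Trans (piA p) s d s'
      t-star : ∀ {p p' s s'} → Trans p s p' s' → Trans (star p) s (seq p' (star p)) s'
      t-parl : ∀ {p p' q s s'} → Trans p s p' s' → Trans (par p q) s (par p' q) s'
      t-parr : ∀ {p q q' s s'} → Trans q s q' s' → Trans (par p q) s (par p q') s'

    Step : Prog 0 0 × Sit → Prog 0 0 × Sit → Set
    Step (p , s) (p' , s') = Trans p s p' s'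

    Trans* : Prog 0 0 × Sit → Prog 0 0 × Sit → Set
    Trans* = Star Step

    Do : Prog 0 0 → Sit → Sit → Set
    Do p s s' = Σ[ p' ∈ Prog 0 0 ] (Trans* (p , s) (p' , s') × Final p' s')

    SitDetermined : Prog 0 0 → Sit → Set
    SitDetermined p s = ∀ s' p' p'' → Trans* (p , s) (p' , s') →
                        Trans* (p , s) (p'' , s') → p' ≡ p''

  record BAT : Set₁ where
    field
      DS0  : Fml 0 0 → Set
      poss : (A : Fin nA) → Fml (arA A) 0      -- Poss(A(x⃗),s) ≡ poss A [x⃗,s]
      ssa  : (F : Fin nF) → Fml (arF F) 1      -- F(x⃗,do(a,s)) ≡ ssa F [x⃗,a,s]

  -- M ⊨ D (D_ca, D_coa built into the fixed domains Act and ℕ; Σ below)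
  record IsModel (D : BAT) (M : Structure) : Set₁ where
    open BAT D
    open Structure M
    field
      do-inj    : ∀ a a' s s' → doS a s ≡ doS a' s' → (a ≡ a') × (s ≡ s')
      induction : (P : Sit → Set) → P S0 → (∀ a s → P s → P (doS a s)) → ∀ s → P s
      ⊏-S0      : ∀ s → ¬ (s ⊏ S0)
      ⊏-do      : ∀ s a s' → (s ⊏ doS a s') ⟺ ((s ⊏ s') ⊎ (s ≡ s'))
      initAx    : ∀ φ → DS0 φ → sat M φ [] [] S0
      possAx    : ∀ A xs s → Poss (A , xs) s ⟺ sat M (poss A) xs [] s
      ssaAx     : ∀ F xs a s → Holds F xs (doS a s) ⟺ sat M (ssa F) xs (a ∷ []) s

  Satisfiable : BAT → Set₁
  Satisfiable D = Σ[ M ∈ Structure ] IsModel D M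

  _⊨S0_ : BAT → Fml 0 0 → Set₁
  D ⊨S0 φ = ∀ (M : Structure) → (∀ ψ → BAT.DS0 D ψ → sat M ψ [] [] (Structure.S0 M)) →
            sat M φ [] [] (Structure.S0 M)

  CompleteS0 : BAT → Set₁
  CompleteS0 D = ∀ (φ : Fml 0 0) → (D ⊨S0 φ) ⊎ (D ⊨S0 notF φ)

module Refine (Sh Sl : Sig) where
  module H = Lang Sh
  module L = Lang Sl
  open Sig Sh

  record RefMap (Dl : L.BAT) : Set₁ where
    field
      mA : (A : Fin nA) → L.Prog (arA A) 0
      mF : (F : Fin nF) → L.Fml (arF F) 0
      sd : ∀ (Ml : L.Structure) → L.IsModel Dl Ml → ∀ A (xs : Vec ℕ (arA A))
             (s : L.Structure.Sit Ml) → L.Golog.SitDetermined Ml (L.instP xs (mA A)) s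

  module _ {Dl : L.BAT} (m : RefMap Dl) (Mh : H.Structure) (Ml : L.Structure) where
    open RefMap m
    private
      module Mh = H.Structure Mh
      module Ml = L.Structure Ml
      module G = L.Golog Ml

    MEquiv : Mh.Sit → Ml.Sit → Set
    MEquiv sh sl = ∀ (F : Fin nF) (xs : Vec ℕ (arF F)) →
                   Mh.Holds F xs sh ⟺ L.sat Ml (mF F) xs [] sl

    IsBisim : (Mh.Sit → Ml.Sit → Set) → Set
    IsBisim B = ∀ sh sl → B sh sl →
        MEquiv sh sl
      × (∀ (A : Fin nA) (xs : Vec ℕ (arA A)) (sh' : Mh.Sit) →
           Mh.Poss (A , xs) sh × (sh' ≡ Mh.doS (A , xs) sh) →
           Σ[ sl' ∈ Ml.Sit ] (G.Do (L.instP xs (mA A)) sl sl' × B sh' sl'))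
      × (∀ (A : Fin nA) (xs : Vec ℕ (arA A)) (sl' : Ml.Sit) →
           G.Do (L.instP xs (mA A)) sl sl' →
           Σ[ sh' ∈ Mh.Sit ] ((Mh.Poss (A , xs) sh × (sh' ≡ Mh.doS (A , xs) sh)) × B sh' sl'))

    Bisimilar : Set₁
    Bisimilar = Σ[ B ∈ (Mh.Sit → Ml.Sit → Set) ] (IsBisim B × B Mh.S0 Ml.S0)

  SoundAbs : (Dh : H.BAT) (Dl : L.BAT) → RefMap Dl → Set₁
  SoundAbs Dh Dl m = ∀ (Ml : L.Structure) → L.IsModel Dl Ml →
                     Σ[ Mh ∈ H.Structure ] (H.IsModel Dh Mh × Bisimilar m Mh Ml)

  CompleteAbs : (Dh : H.BAT) (Dl : L.BAT) → RefMap Dl → Set₁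
  CompleteAbs Dh Dl m = ∀ (Mh : H.Structure) → H.IsModel Dh Mh →
                        Σ[ Ml ∈ L.Structure ] (L.IsModel Dl Ml × Bisimilar m Mh Ml)

-- If D^h_{S0} is complete, any two models of D^h satisfy the same fluents initially; since
-- fluents and preconditions of successor situations are determined by the successor state and
-- precondition axioms, the two models then agree along every common action history.  Soundness
-- applied to one model of D^l yields a model M_h' of D^h bisimilar to it, and any other model
-- M_h of D^h inherits that bisimulation by first matching its situations with those of M_h'
-- having the same history.
module Submission where

open import Defs
open import Data.Nat using (ℕ)
open import Data.Vec using (Vec; []; _∷_; map)
open import Data.Product using (Σ-syntax; _×_; _,_; proj₁; proj₂)
open import Data.Sum using (_⊎_; inj₁; inj₂) renaming (map to ⊎-map)
open import Data.Empty using (⊥-elim)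
open import Relation.Nullary using (¬_)
open import Function using (case_of_)
open import Relation.Binary.PropositionalEquality using (_≡_; refl; sym; cong; subst)

private
  variable
    A B C D : Set

⟺-refl : A ⟺ A
⟺-refl = (λ x → x) , (λ x → x)

⟺-sym : A ⟺ B → B ⟺ A
⟺-sym (f , g) = g , f

⟺-trans : A ⟺ B → B ⟺ C → A ⟺ C
⟺-trans (f , g) (h , k) = (λ x → h (f x)) , (λ z → g (k z))

¬-cong : A ⟺ B → (¬ A) ⟺ (¬ B)
¬-cong (f , g) = (λ h x → h (g x)) , (λ h y → h (f y))

×-cong : A ⟺ B → C ⟺ D → (A × C) ⟺ (B × D)
×-cong (f , g) (h , k) = (λ (a , c) → f a , h c) , (λ (b , d) → g b , k d)

⊎-cong : A ⟺ B → C ⟺ D → (A ⊎ C) ⟺ (B ⊎ D)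
⊎-cong (f , g) (h , k) = ⊎-map f h , ⊎-map g k

→-cong : A ⟺ B → C ⟺ D → (A → C) ⟺ (B → D)
→-cong (f , g) (h , k) = (λ u b → h (u (g b))) , (λ v a → k (v (f a)))

Π-cong : {I : Set} {P Q : I → Set} → (∀ i → P i ⟺ Q i) → (∀ i → P i) ⟺ (∀ i → Q i)
Π-cong e = (λ u i → proj₁ (e i) (u i)) , (λ v i → proj₂ (e i) (v i))

Σ-cong : {I : Set} {P Q : I → Set} → (∀ i → P i ⟺ Q i) → (Σ[ i ∈ I ] P i) ⟺ (Σ[ i ∈ I ] Q i)
Σ-cong e = (λ (i , p) → i , proj₁ (e i) p) , (λ (i , q) → i , proj₂ (e i) q)

module Models (S : Sig) where
  open Lang S
  open Structure

  FluentEquiv : (M M' : Structure) → Sit M → Sit M' → Set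
  FluentEquiv M M' s s' = ∀ F xs → Holds M F xs s ⟺ Holds M' F xs s'

  sat-cong : ∀ {M M' s s'} → FluentEquiv M M' s s' →
             ∀ {n k} (φ : Fml n k) ρ σ → sat M φ ρ σ s ⟺ sat M' φ ρ σ s'
  sat-cong e trueF      ρ σ = ⟺-refl
  sat-cong e falseF     ρ σ = ⟺-refl
  sat-cong e (flu F ts) ρ σ = e F (map (evalO ρ) ts)
  sat-cong e (eqO t u)  ρ σ = ⟺-refl
  sat-cong e (eqA t u)  ρ σ = ⟺-refl
  sat-cong e (notF φ)   ρ σ = ¬-cong (sat-cong e φ ρ σ)
  sat-cong e (andF φ ψ) ρ σ = ×-cong (sat-cong e φ ρ σ) (sat-cong e ψ ρ σ)
  sat-cong e (orF φ ψ)  ρ σ = ⊎-cong (sat-cong e φ ρ σ) (sat-cong e ψ ρ σ)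
  sat-cong e (impF φ ψ) ρ σ = →-cong (sat-cong e φ ρ σ) (sat-cong e ψ ρ σ)
  sat-cong e (allO φ)   ρ σ = Π-cong λ x → sat-cong e φ (x ∷ ρ) σ
  sat-cong e (exO φ)    ρ σ = Σ-cong λ x → sat-cong e φ (x ∷ ρ) σ
  sat-cong e (allA φ)   ρ σ = Π-cong λ a → sat-cong e φ ρ (a ∷ σ)
  sat-cong e (exA φ)    ρ σ = Σ-cong λ a → sat-cong e φ ρ (a ∷ σ)

  evalO-names : ∀ {n} (xs : Vec ℕ n) → map (evalO []) (map name xs) ≡ xs
  evalO-names []       = refl
  evalO-names (x ∷ xs) = cong (x ∷_) (evalO-names xs)

  sat-ground-atom : ∀ M F xs s → sat M (flu F (map name xs)) [] [] s ⟺ Holds M F xs s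
  sat-ground-atom M F xs s = subst (λ ys → Holds M F ys s) (evalO-names xs)
                           , subst (λ ys → Holds M F ys s) (sym (evalO-names xs))

  -- The ground atom F(xs) is a sentence, so completeness decides it uniformly in all models.
  completeS0⇒fluentEquiv-S0 : ∀ {D M M'} → CompleteS0 D → IsModel D M → IsModel D M' →
                              FluentEquiv M M' (S0 M) (S0 M')
  completeS0⇒fluentEquiv-S0 {M = M} {M'} complete isM isM' F xs
    with complete (flu F (map name xs))
  ... | inj₁ holds =
      (λ _ → proj₁ (sat-ground-atom M' F xs _) (holds M' (IsModel.initAx isM')))
    , (λ _ → proj₁ (sat-ground-atom M F xs _) (holds M (IsModel.initAx isM)))
  ... | inj₂ refuted =
      (λ h → ⊥-elim (refuted M (IsModel.initAx isM) (proj₂ (sat-ground-atom M F xs _) h)))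
    , (λ h → ⊥-elim (refuted M' (IsModel.initAx isM') (proj₂ (sat-ground-atom M' F xs _) h)))

  data SameHistory (M M' : Structure) : Sit M → Sit M' → Set where
    S0∼S0 : SameHistory M M' (S0 M) (S0 M')
    do∼do : ∀ {s s'} a → SameHistory M M' s s' → SameHistory M M' (doS M a s) (doS M' a s')

  module _ {D : BAT} {M M' : Structure} (isM : IsModel D M) (isM' : IsModel D M')
           (initial : FluentEquiv M M' (S0 M) (S0 M')) where
    open IsModel

    sameHistory⇒fluentEquiv : ∀ {s s'} → SameHistory M M' s s' → FluentEquiv M M' s s'
    sameHistory⇒fluentEquiv S0∼S0 = initial
    sameHistory⇒fluentEquiv (do∼do {s} {s'} a h) F xs =
      ⟺-trans (ssaAx isM F xs a s)
        (⟺-trans (sat-cong (sameHistory⇒fluentEquiv h) (BAT.ssa D F) xs (a ∷ []))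
                 (⟺-sym (ssaAx isM' F xs a s')))

    sameHistory⇒possEquiv : ∀ {s s'} → SameHistory M M' s s' →
                            ∀ A xs → Poss M (A , xs) s ⟺ Poss M' (A , xs) s'
    sameHistory⇒possEquiv {s} {s'} h A xs =
      ⟺-trans (possAx isM A xs s)
        (⟺-trans (sat-cong (sameHistory⇒fluentEquiv h) (BAT.poss D A) xs [])
                 (⟺-sym (possAx isM' A xs s')))

module _ {Sh Sl : Sig} {Dh : Lang.BAT Sh} {Dl : Lang.BAT Sl} (m : Refine.RefMap Sh Sl Dl) where
  open Lang.Structure
  open Models Sh
  open Refine Sh Sl using (Bisimilar; IsBisim)

  bisimilar-transfer : ∀ {Mh Mh' Ml} → Lang.IsModel Sh Dh Mh → Lang.IsModel Sh Dh Mh' →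
                       FluentEquiv Mh Mh' (S0 Mh) (S0 Mh') →
                       Bisimilar m Mh' Ml → Bisimilar m Mh Ml
  bisimilar-transfer {Mh} {Mh'} {Ml} isMh isMh' initial (B , isB , B₀) =
    B∘same , isB∘same , (S0 Mh' , S0∼S0 , B₀)
    where
    B∘same : Sit Mh → Sit Ml → Set
    B∘same sh sl = Σ[ sh' ∈ Sit Mh' ] (SameHistory Mh Mh' sh sh' × B sh' sl)

    fluents : ∀ {sh sh'} → SameHistory Mh Mh' sh sh' → FluentEquiv Mh Mh' sh sh'
    fluents = sameHistory⇒fluentEquiv isMh isMh' initial

    poss : ∀ {sh sh'} → SameHistory Mh Mh' sh sh' →
           ∀ A xs → Poss Mh (A , xs) sh ⟺ Poss Mh' (A , xs) sh'
    poss = sameHistory⇒possEquiv isMh isMh' initial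

    isB∘same : IsBisim m Mh Ml B∘same
    isB∘same sh sl (sh' , same , b) with isB sh' sl b
    ... | equiv , forth , back =
        (λ F xs → ⟺-trans (fluents same F xs) (equiv F xs))
      , (λ { A xs _ (possible , refl) →
               let sl' , run , b' = forth A xs _ (proj₁ (poss same A xs) possible , refl)
               in sl' , run , (_ , do∼do (A , xs) same , b') })
      , (λ A xs sl' run → case back A xs sl' run of λ where
               (_ , (possible' , refl) , b') →
                 _ , (proj₂ (poss same A xs) possible' , refl) , (_ , do∼do (A , xs) same , b'))

corollary6 : (Sh Sl : Sig) (Dh : Lang.BAT Sh) (Dl : Lang.BAT Sl) (m : Refine.RefMap Sh Sl Dl) →
    Lang.CompleteS0 Sh Dh → Lang.Satisfiable Sl Dl →
    Refine.SoundAbs Sh Sl Dh Dl m → Refine.CompleteAbs Sh Sl Dh Dl m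
corollary6 Sh Sl Dh Dl m complete (Ml , isMl) sound Mh isMh =
  let Mh' , isMh' , Mh'∼Ml = sound Ml isMl
  in Ml , isMl , bisimilar-transfer m isMh isMh'
                   (Models.completeS0⇒fluentEquiv-S0 Sh complete isMh isMh') Mh'∼Ml
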